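{- Let $G$ be a finite simple graph and $v$ a vertex of $G$. Then $$\mathrm{dim}_G(v)=\mathrm{dim}\,B_G(v)=1+\mathrm{dim}\,S_G(v).$$
   Context: For a vertex $v$ of $G$, the unit sphere $S_G(v)$ is the subgraph of $G$ induced on the set of neighbors of $v$, and the unit ball $B_G(v)$ is the subgraph of $G$ induced on $v$ together with its neighbors. The inductive dimension is defined recursively: $\mathrm{dim}\,H=-1$ if $H$ is the empty graph; otherwise $\mathrm{dim}\,H=\frac{1}{|H|}\sum_{w\in V(H)}\mathrm{dim}_H(w)$, where $\mathrm{dim}_H(w)=1+\mathrm{dim}\,S_H(w)$ and $|H|$ is the number of vertices of $H$. -}

module Defs where

open import Data.Nat using (ℕ; zero; suc)
open import Data.Bool using (Bool)
open import Data.Fin using (Fin)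
open import Data.Fin.Subset using (Subset; inside; outside; _∩_; _∪_; ⁅_⁆; ⊤)
open import Data.Vec using (tabulate; lookup)
open import Data.List using (List; []; _∷_; map; filter; length; foldr)
open import Data.List using (allFin)
open import Data.Integer using (+_)
open import Data.Rational using (ℚ; 0ℚ; 1ℚ; _+_; _*_; _/_; -_)
open import Relation.Nullary using (¬_; does)
open import Relation.Binary using (Rel; Decidable)
open import Relation.Binary.PropositionalEquality using (_≡_)
open import Level using (0ℓ)
open import Data.Fin.Subset.Properties using (_∈?_)

record Graph (n : ℕ) : Set₁ where
  field
    Adj   : Rel (Fin n) 0ℓ
    adj?  : Decidable Adj
    sym   : ∀ {u w} → Adj u w → Adj w u
    irrefl : ∀ {u} → ¬ Adj u u

module _ {n : ℕ} (G : Graph n) where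
  open Graph G

  -- set of neighbours of w (vertex set of the unit sphere S_G(w))
  nbrs : Fin n → Subset n
  nbrs w = tabulate (λ u → does (adj? w u))

  ballSet : Fin n → Subset n
  ballSet w = ⁅ w ⁆ ∪ nbrs w

elems : {n : ℕ} → Subset n → List (Fin n)
elems {n} U = filter (_∈? U) (allFin n)

-- arithmetic mean of a list of rationals; the empty list gets -1
-- (the dimension of the empty graph).
meanOr-1 : List ℚ → ℚ
meanOr-1 []       = - 1ℚ
meanOr-1 (x ∷ xs) = foldr _+_ 0ℚ (x ∷ xs) * (+ 1 / suc (length xs))

module _ {n : ℕ} (G : Graph n) where

  -- dimF k U : inductive dimension of the induced subgraph G[U], computed
  -- with recursion fuel k.  The fuel is only a termination device: each
  -- recursive call is on U ∩ N(w) with w ∈ U, w ∉ N(w), which is strictly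
  -- smaller than U, so whenever |U| ≤ k the fuel never runs out on a
  -- nonempty set (dimF 0 U is only reached for U empty, where -1 is correct).
  --   dim H = -1 if H is empty, otherwise the mean over w ∈ H of
  --   dim_H(w) = 1 + dim S_H(w), and S_{G[U]}(w) = G[U ∩ N_G(w)].
  dimF : ℕ → Subset n → ℚ
  dimF zero    U = - 1ℚ
  dimF (suc k) U = meanOr-1 (map (λ w → 1ℚ + dimF k (U ∩ nbrs G w)) (elems U))

  dim : Subset n → ℚ
  dim U = dimF n U

  dimAt : Subset n → Fin n → ℚ
  dimAt U w = 1ℚ + dim (U ∩ nbrs G w)

  vdim : Fin n → ℚ
  vdim v = dimAt ⊤ v

module Submission where

-- The ball B(v) is the cone v * S(v) over the sphere, and coning raises the inductive
-- dimension by one.  In a cone v * U (U ⊆ S(v)) the sphere of the apex is U and the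
-- sphere of w ∈ U is again a cone, v * S_U(w); so by induction w has dimension
-- 1 + dim_U(w), the apex has 1 + dim U, and the mean of these |U| + 1 values is
-- 1 + dim U.  The recursion fuel of dimF never matters, since a sphere S_U(w) with
-- w ∈ U is strictly smaller than U.

open import Defs
open import Data.Nat using (ℕ; zero; suc; _≤_; _<_)
import Data.Nat.Properties as ℕ
open import Data.Fin using (Fin; zero; suc)
open import Data.Fin.Subset using (Subset; inside; outside; _∈_; _∉_; _⊆_; _∩_; _∪_; ⁅_⁆; ⊥; ∣_∣)
open import Data.Fin.Subset.Properties
open import Data.Vec using ([]; _∷_; here; there)
open import Data.Vec.Properties using ([]=⇒lookup; lookup⇒[]=; lookup∘tabulate)
open import Data.List using (List; []; _∷_; map; filter; length; foldr; tabulate; allFin)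
open import Data.List.Properties using (map-∘; map-cong; map-cong-local; map-tabulate; length-map)
open import Data.List.Relation.Unary.All as All using (All)
open import Data.List.Relation.Unary.All.Properties using (all-filter)
open import Data.List.Relation.Binary.Permutation.Propositional using (_↭_; ↭-refl; ↭-reflexive; ↭-swap; ↭⇒↭ₛ; module PermutationReasoning)
open import Data.List.Relation.Binary.Permutation.Propositional.Properties using (map⁺; ↭-length)
import Data.List.Relation.Binary.Permutation.Setoid.Properties as PermutationSetoid
import Data.Integer as ℤ
import Data.Integer.Properties as ℤ
open import Data.Rational using (ℚ; mkℚ; 0ℚ; 1ℚ; _+_; _*_; _/_; 1/_)
open import Data.Rational.Properties using (+-0-isCommutativeMonoid; *-assoc; *-comm; *-identityʳ; *-zeroˡ; *-inverseˡ; ↥p/↧p≡p)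
open import Data.Rational.Solver using (module +-*-Solver)
open import Data.Nat.Coprimality as Coprime using (1-coprimeTo)
open import Data.Bool using (true)
open import Data.Product using (_×_; _,_)
open import Data.Sum using (inj₁; inj₂)
open import Data.Empty using (⊥-elim)
open import Function using (_∘_; id)
open import Relation.Nullary using (yes; no; does; proof)
open import Relation.Nullary.Reflects using (Reflects; invert)
open import Relation.Nullary.Decidable using (dec-true)
open import Relation.Binary.PropositionalEquality

sumℚ : List ℚ → ℚ
sumℚ = foldr _+_ 0ℚ

fromℕ : ℕ → ℚ
fromℕ zero    = 0ℚ
fromℕ (suc k) = 1ℚ + fromℕ k

fromℕ≡k/1 : ∀ k → fromℕ k ≡ mkℚ (ℤ.+ k) 0 (Coprime.sym (1-coprimeTo k))
fromℕ≡k/1 zero    = refl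
fromℕ≡k/1 (suc k) = begin
  1ℚ + fromℕ k                     ≡⟨ cong (1ℚ +_) (fromℕ≡k/1 k) ⟩
  (ℤ.+ 1 ℤ.+ ℤ.+ k ℤ.* ℤ.+ 1) / 1  ≡⟨ cong (λ z → (ℤ.+ 1 ℤ.+ z) / 1) (ℤ.*-identityʳ (ℤ.+ k)) ⟩
  (ℤ.+ suc k) / 1                  ≡⟨ ↥p/↧p≡p _ ⟩
  mkℚ (ℤ.+ suc k) 0 _              ∎
  where open ≡-Reasoning

-- Both factors are brought to normal form, where 1/ computes: 1/ (1 / (k + 1)) is (k + 1) / 1.
fromℕ-suc*1/suc : ∀ k → fromℕ (suc k) * (ℤ.+ 1 / suc k) ≡ 1ℚ
fromℕ-suc*1/suc k = begin
  fromℕ (suc k) * (ℤ.+ 1 / suc k) ≡⟨ cong₂ _*_ (fromℕ≡k/1 (suc k)) (↥p/↧p≡p q) ⟩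
  1/ q * q                        ≡⟨ *-inverseˡ q ⟩
  1ℚ                              ∎
  where
  open ≡-Reasoning
  q = mkℚ (ℤ.+ 1) k (1-coprimeTo (suc k))

sumℚ-↭ : ∀ {xs ys} → xs ↭ ys → sumℚ xs ≡ sumℚ ys
sumℚ-↭ p = PermutationSetoid.foldr-commMonoid (setoid ℚ) +-0-isCommutativeMonoid (↭⇒↭ₛ p)

meanOr-1-↭ : ∀ {xs ys} → xs ↭ ys → meanOr-1 xs ≡ meanOr-1 ys
meanOr-1-↭ {[]}    {[]}    _ = refl
meanOr-1-↭ {[]}    {_ ∷ _} p with () ← ↭-length p
meanOr-1-↭ {_ ∷ _} {[]}    p with () ← ↭-length p
meanOr-1-↭ {_ ∷ _} {_ ∷ _} p =
  cong₂ (λ s m → s * (ℤ.+ 1 / suc m)) (sumℚ-↭ p) (ℕ.suc-injective (↭-length p))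

sumℚ-map-1+ : ∀ xs → sumℚ (map (1ℚ +_) xs) ≡ fromℕ (length xs) + sumℚ xs
sumℚ-map-1+ []       = refl
sumℚ-map-1+ (x ∷ xs) = begin
  (1ℚ + x) + sumℚ (map (1ℚ +_) xs)    ≡⟨ cong ((1ℚ + x) +_) (sumℚ-map-1+ xs) ⟩
  (1ℚ + x) + (fromℕ (length xs) + s) ≡⟨ solve 3 (λ a l t → (con 1ℚ :+ a) :+ (l :+ t) := (con 1ℚ :+ l) :+ (a :+ t)) refl x (fromℕ (length xs)) s ⟩
  (1ℚ + fromℕ (length xs)) + (x + s) ∎
  where
  open ≡-Reasoning
  open +-*-Solver
  s = sumℚ xs

sumℚ≡meanOr-1*length : ∀ x xs → sumℚ (x ∷ xs) ≡ meanOr-1 (x ∷ xs) * fromℕ (suc (length xs))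
sumℚ≡meanOr-1*length x xs = sym (begin
  s * i * ℓ   ≡⟨ *-assoc s i ℓ ⟩
  s * (i * ℓ) ≡⟨ cong (s *_) (trans (*-comm i ℓ) (fromℕ-suc*1/suc (length xs))) ⟩
  s * 1ℚ      ≡⟨ *-identityʳ s ⟩
  s           ∎)
  where
  open ≡-Reasoning
  s = sumℚ (x ∷ xs)
  i = ℤ.+ 1 / suc (length xs)
  ℓ = fromℕ (suc (length xs))

meanOr-1-zeros : ∀ {A : Set} (xs : List A) → meanOr-1 (0ℚ ∷ map (λ _ → 0ℚ) xs) ≡ 0ℚ
meanOr-1-zeros xs = trans (cong (λ s → (0ℚ + s) * i) (sumℚ-zeros xs)) (*-zeroˡ i)
  where
  i = ℤ.+ 1 / suc (length (map (λ _ → 0ℚ) xs))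
  sumℚ-zeros : ∀ {A : Set} (xs : List A) → sumℚ (map (λ _ → 0ℚ) xs) ≡ 0ℚ
  sumℚ-zeros []       = refl
  sumℚ-zeros (_ ∷ xs) = cong (0ℚ +_) (sumℚ-zeros xs)

meanOr-1-cone : ∀ xs → meanOr-1 ((1ℚ + meanOr-1 xs) ∷ map (1ℚ +_) xs) ≡ 1ℚ + meanOr-1 xs
meanOr-1-cone []       = refl
meanOr-1-cone (x ∷ xs) = begin
  ((1ℚ + D) + sumℚ (map (1ℚ +_) (x ∷ xs))) * (ℤ.+ 1 / suc (length (map (1ℚ +_) (x ∷ xs))))
    ≡⟨ cong₂ (λ s m → ((1ℚ + D) + s) * (ℤ.+ 1 / suc m)) (sumℚ-map-1+ (x ∷ xs)) (length-map (1ℚ +_) (x ∷ xs)) ⟩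
  ((1ℚ + D) + (ℓ + sumℚ (x ∷ xs))) * i
    ≡⟨ cong (λ s → ((1ℚ + D) + (ℓ + s)) * i) (sumℚ≡meanOr-1*length x xs) ⟩
  ((1ℚ + D) + (ℓ + D * ℓ)) * i
    ≡⟨ solve 3 (λ d l j → ((con 1ℚ :+ d) :+ (l :+ d :* l)) :* j := (con 1ℚ :+ d) :* ((con 1ℚ :+ l) :* j)) refl D ℓ i ⟩
  (1ℚ + D) * (fromℕ (suc (suc (length xs))) * i)
    ≡⟨ cong ((1ℚ + D) *_) (fromℕ-suc*1/suc (suc (length xs))) ⟩
  (1ℚ + D) * 1ℚ
    ≡⟨ *-identityʳ (1ℚ + D) ⟩
  1ℚ + D ∎
  where
  open ≡-Reasoning
  open +-*-Solver
  D = meanOr-1 (x ∷ xs)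
  ℓ = fromℕ (suc (length xs))
  i = ℤ.+ 1 / suc (suc (length xs))

filter-∈?-map-suc : ∀ {n} b (p : Subset n) xs →
  filter (_∈? (b ∷ p)) (map suc xs) ≡ map suc (filter (_∈? p) xs)
filter-∈?-map-suc b p []       = refl
filter-∈?-map-suc b p (x ∷ xs) with x ∈? p
... | yes _ = cong (suc x ∷_) (filter-∈?-map-suc b p xs)
... | no _  = filter-∈?-map-suc b p xs

elems-∷-tail : ∀ {n} b (p : Subset n) → filter (_∈? (b ∷ p)) (tabulate suc) ≡ map suc (elems p)
elems-∷-tail {n} b p = trans (cong (filter (_∈? (b ∷ p))) (sym (map-tabulate id suc)))
                             (filter-∈?-map-suc b p (allFin n))

elems-inside : ∀ {n} (p : Subset n) → elems (inside ∷ p) ≡ zero ∷ map suc (elems p)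
elems-inside p = cong (zero ∷_) (elems-∷-tail inside p)

elems-outside : ∀ {n} (p : Subset n) → elems (outside ∷ p) ≡ map suc (elems p)
elems-outside p = elems-∷-tail outside p

elems-⊆ : ∀ {n} (p : Subset n) → All (_∈ p) (elems p)
elems-⊆ {n} p = all-filter (_∈? p) (allFin n)

elems-∣∣≤0 : ∀ {n} (p : Subset n) → ∣ p ∣ ≤ 0 → elems p ≡ []
elems-∣∣≤0 []            _   = refl
elems-∣∣≤0 (inside ∷ p)  ()
elems-∣∣≤0 (outside ∷ p) ∣p∣≤0 = trans (elems-outside p) (cong (map suc) (elems-∣∣≤0 p ∣p∣≤0))

elems-⁅⁆∪ : ∀ {n} {x : Fin n} {p : Subset n} → x ∉ p → elems (⁅ x ⁆ ∪ p) ↭ x ∷ elems p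
elems-⁅⁆∪ {x = zero} {outside ∷ p} _ = ↭-reflexive (begin
  elems (inside ∷ (⊥ ∪ p))       ≡⟨ elems-inside (⊥ ∪ p) ⟩
  zero ∷ map suc (elems (⊥ ∪ p)) ≡⟨ cong (λ q → zero ∷ map suc (elems q)) (∪-identityˡ p) ⟩
  zero ∷ map suc (elems p)       ≡⟨ cong (zero ∷_) (elems-outside p) ⟨
  zero ∷ elems (outside ∷ p)     ∎)
  where open ≡-Reasoning
elems-⁅⁆∪ {x = zero} {inside ∷ p} x∉p = ⊥-elim (x∉p here)
elems-⁅⁆∪ {x = suc x} {outside ∷ p} x∉p = begin
  elems (outside ∷ (⁅ x ⁆ ∪ p))    ≡⟨ elems-outside (⁅ x ⁆ ∪ p) ⟩
  map suc (elems (⁅ x ⁆ ∪ p))      ↭⟨ map⁺ suc (elems-⁅⁆∪ (x∉p ∘ there)) ⟩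
  suc x ∷ map suc (elems p)        ≡⟨ cong (suc x ∷_) (elems-outside p) ⟨
  suc x ∷ elems (outside ∷ p)      ∎
  where open PermutationReasoning
elems-⁅⁆∪ {x = suc x} {inside ∷ p} x∉p = begin
  elems (inside ∷ (⁅ x ⁆ ∪ p))       ≡⟨ elems-inside (⁅ x ⁆ ∪ p) ⟩
  zero ∷ map suc (elems (⁅ x ⁆ ∪ p)) <⟨ map⁺ suc (elems-⁅⁆∪ (x∉p ∘ there)) ⟩
  zero ∷ suc x ∷ map suc (elems p)   ↭⟨ ↭-swap zero (suc x) ↭-refl ⟩
  suc x ∷ zero ∷ map suc (elems p)   ≡⟨ cong (suc x ∷_) (elems-inside p) ⟨
  suc x ∷ elems (inside ∷ p)         ∎
  where open PermutationReasoning

module _ {n : ℕ} (G : Graph n) where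
  open Graph G using (Adj; adj?; irrefl) renaming (sym to Adj-sym)

  private
    N : Fin n → Subset n
    N = nbrs G

  ∈-nbrs⁻ : ∀ {w x} → x ∈ N w → Adj w x
  ∈-nbrs⁻ {w} {x} x∈Nw = invert (subst (Reflects (Adj w x)) does≡true (proof (adj? w x)))
    where
    does≡true : does (adj? w x) ≡ true
    does≡true = trans (sym (lookup∘tabulate (λ u → does (adj? w u)) x)) ([]=⇒lookup x∈Nw)

  ∈-nbrs⁺ : ∀ {w x} → Adj w x → x ∈ N w
  ∈-nbrs⁺ {w} {x} a = lookup⇒[]= x (N w)
    (trans (lookup∘tabulate (λ u → does (adj? w u)) x) (dec-true (adj? w x) a))

  ∉-nbrs-self : ∀ {w} → w ∉ N w
  ∉-nbrs-self = irrefl ∘ ∈-nbrs⁻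

  nbrs-sym : ∀ {v w} → w ∈ N v → v ∈ N w
  nbrs-sym = ∈-nbrs⁺ ∘ Adj-sym ∘ ∈-nbrs⁻

  ∣∩nbrs∣<∣∣ : ∀ {U w} → w ∈ U → ∣ U ∩ N w ∣ < ∣ U ∣
  ∣∩nbrs∣<∣∣ {U} {w} w∈U = p⊂q⇒∣p∣<∣q∣ (p∩q⊆p U (N w) , w , w∈U , ∉-nbrs-self ∘ p∩q⊆q U (N w))

  dimF-suc : ∀ k {U} → ∣ U ∣ ≤ k → dimF G k U ≡ dimF G (suc k) U
  dimF-suc zero    {U} ∣U∣≤0 =
    cong (λ ws → meanOr-1 (map (λ w → 1ℚ + dimF G zero (U ∩ N w)) ws)) (sym (elems-∣∣≤0 U ∣U∣≤0))
  dimF-suc (suc k) {U} ∣U∣≤k = cong meanOr-1 (map-cong-local (All.map sphere (elems-⊆ U)))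
    where
    sphere : ∀ {w} → w ∈ U → 1ℚ + dimF G k (U ∩ N w) ≡ 1ℚ + dimF G (suc k) (U ∩ N w)
    sphere w∈U = cong (1ℚ +_) (dimF-suc k (ℕ.≤-pred (ℕ.<-≤-trans (∣∩nbrs∣<∣∣ w∈U) ∣U∣≤k)))

  module _ (v : Fin n) where

    cone-sphere-apex : ∀ {U} → U ⊆ N v → (⁅ v ⁆ ∪ U) ∩ N v ≡ U
    cone-sphere-apex {U} U⊆Nv = ⊆-antisym sphere⊆U (λ x∈U → x∈p∩q⁺ (x∈p∪q⁺ (inj₂ x∈U) , U⊆Nv x∈U))
      where
      sphere⊆U : (⁅ v ⁆ ∪ U) ∩ N v ⊆ U
      sphere⊆U x∈ with x∈p∩q⁻ (⁅ v ⁆ ∪ U) (N v) x∈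
      ... | x∈⁅v⁆∪U , x∈Nv with x∈p∪q⁻ ⁅ v ⁆ U x∈⁅v⁆∪U
      ...   | inj₁ x∈⁅v⁆ = ⊥-elim (∉-nbrs-self (subst (_∈ N v) (x∈⁅y⁆⇒x≡y v x∈⁅v⁆) x∈Nv))
      ...   | inj₂ x∈U   = x∈U

    cone-sphere-base : ∀ {U w} → U ⊆ N v → w ∈ U → (⁅ v ⁆ ∪ U) ∩ N w ≡ ⁅ v ⁆ ∪ (U ∩ N w)
    cone-sphere-base {U} {w} U⊆Nv w∈U = ⊆-antisym sphere⊆cone cone⊆sphere
      where
      sphere⊆cone : (⁅ v ⁆ ∪ U) ∩ N w ⊆ ⁅ v ⁆ ∪ (U ∩ N w)
      sphere⊆cone x∈ with x∈p∩q⁻ (⁅ v ⁆ ∪ U) (N w) x∈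
      ... | x∈⁅v⁆∪U , x∈Nw with x∈p∪q⁻ ⁅ v ⁆ U x∈⁅v⁆∪U
      ...   | inj₁ x∈⁅v⁆ = x∈p∪q⁺ (inj₁ x∈⁅v⁆)
      ...   | inj₂ x∈U   = x∈p∪q⁺ (inj₂ (x∈p∩q⁺ (x∈U , x∈Nw)))
      cone⊆sphere : ⁅ v ⁆ ∪ (U ∩ N w) ⊆ (⁅ v ⁆ ∪ U) ∩ N w
      cone⊆sphere x∈ with x∈p∪q⁻ ⁅ v ⁆ (U ∩ N w) x∈
      ... | inj₁ x∈⁅v⁆ = x∈p∩q⁺ (x∈p∪q⁺ (inj₁ x∈⁅v⁆) ,
                                 subst (_∈ N w) (sym (x∈⁅y⁆⇒x≡y v x∈⁅v⁆)) (nbrs-sym (U⊆Nv w∈U)))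
      ... | inj₂ x∈U∩Nw with x∈p∩q⁻ U (N w) x∈U∩Nw
      ...   | x∈U , x∈Nw = x∈p∩q⁺ (x∈p∪q⁺ (inj₂ x∈U) , x∈Nw)

    dimF-suc-cone : ∀ k {U} → U ⊆ N v →
      dimF G (suc k) (⁅ v ⁆ ∪ U) ≡
      meanOr-1 ((1ℚ + dimF G k U) ∷ map (λ w → 1ℚ + dimF G k (⁅ v ⁆ ∪ (U ∩ N w))) (elems U))
    dimF-suc-cone k {U} U⊆Nv = begin
      meanOr-1 (map vertexDim (elems (⁅ v ⁆ ∪ U)))
        ≡⟨ meanOr-1-↭ (map⁺ vertexDim (elems-⁅⁆∪ (∉-nbrs-self ∘ U⊆Nv))) ⟩
      meanOr-1 (vertexDim v ∷ map vertexDim (elems U))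
        ≡⟨ cong₂ (λ x xs → meanOr-1 (x ∷ xs))
                 (cong (λ S → 1ℚ + dimF G k S) (cone-sphere-apex U⊆Nv))
                 (map-cong-local (All.map (cong (λ S → 1ℚ + dimF G k S) ∘ cone-sphere-base U⊆Nv) (elems-⊆ U))) ⟩
      meanOr-1 ((1ℚ + dimF G k U) ∷ map (λ w → 1ℚ + dimF G k (⁅ v ⁆ ∪ (U ∩ N w))) (elems U)) ∎
      where
      open ≡-Reasoning
      vertexDim : Fin n → ℚ
      vertexDim w = 1ℚ + dimF G k ((⁅ v ⁆ ∪ U) ∩ N w)

    -- At fuel 0 both sides are 0: every vertex of the cone sees a sphere of dimension -1.
    dimF-cone : ∀ k {U} → U ⊆ N v → dimF G (suc k) (⁅ v ⁆ ∪ U) ≡ 1ℚ + dimF G k U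
    dimF-cone zero    {U} U⊆Nv = trans (dimF-suc-cone zero U⊆Nv) (meanOr-1-zeros (elems U))
    dimF-cone (suc k) {U} U⊆Nv = begin
      dimF G (suc (suc k)) (⁅ v ⁆ ∪ U)
        ≡⟨ dimF-suc-cone (suc k) U⊆Nv ⟩
      meanOr-1 ((1ℚ + D) ∷ map (λ w → 1ℚ + dimF G (suc k) (⁅ v ⁆ ∪ (U ∩ N w))) (elems U))
        ≡⟨ cong (λ xs → meanOr-1 ((1ℚ + D) ∷ xs)) (trans (map-cong cone-below (elems U)) (map-∘ (elems U))) ⟩
      meanOr-1 ((1ℚ + D) ∷ map (1ℚ +_) (map (λ w → 1ℚ + dimF G k (U ∩ N w)) (elems U)))
        ≡⟨ meanOr-1-cone (map (λ w → 1ℚ + dimF G k (U ∩ N w)) (elems U)) ⟩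
      1ℚ + D ∎
      where
      open ≡-Reasoning
      D = dimF G (suc k) U
      cone-below : ∀ w → 1ℚ + dimF G (suc k) (⁅ v ⁆ ∪ (U ∩ N w)) ≡ 1ℚ + (1ℚ + dimF G k (U ∩ N w))
      cone-below w = cong (1ℚ +_) (dimF-cone k (U⊆Nv ∘ p∩q⊆p U (N w)))

corollary2 : (n : ℕ) (G : Graph n) (v : Fin n) →
    (vdim G v ≡ dim G (ballSet G v)) × (dim G (ballSet G v) ≡ 1ℚ + dim G (nbrs G v))
corollary2 zero    G ()
corollary2 (suc m) G v = vdim≡dim-ball , dim-ball≡1+dim-sphere
  where
  ∣nbrs∣≤m : ∣ nbrs G v ∣ ≤ m
  ∣nbrs∣≤m = ℕ.≤-pred (subst₂ _<_ (cong ∣_∣ (∩-identityˡ (nbrs G v))) (∣⊤∣≡n (suc m)) (∣∩nbrs∣<∣∣ G ∈⊤))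
  dim-ball≡1+dim-sphere : dim G (ballSet G v) ≡ 1ℚ + dim G (nbrs G v)
  dim-ball≡1+dim-sphere = trans (dimF-cone G v m ⊆-refl) (cong (1ℚ +_) (dimF-suc G m ∣nbrs∣≤m))
  vdim≡dim-ball : vdim G v ≡ dim G (ballSet G v)
  vdim≡dim-ball = trans (cong (λ S → 1ℚ + dim G S) (∩-identityˡ (nbrs G v))) (sym dim-ball≡1+dim-sphere)
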